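{- If $G$ is an arborescence on $n$ vertices with clique number $k$, then $\ell(G)=2n-k$.
   Context: A treelike comparability graph is a graph admitting a transitive orientation whose Hasse diagram (transitive reduction), as an undirected graph, is a tree. A double-arborescence is a treelike comparability graph $G=(V,E)$ with a vertex $r$ such that $V=\{r\}\cup N_G(r)$; it is an arborescence if, under the treelike orientation, such a root is a source or a sink. A word over a finite alphabet is a finite sequence of letters. Letters $a,b$ alternate in a word $w$ if the subsequence of $w$ consisting of all occurrences of $a$ and $b$ is of the form $abab\cdots$ or $baba\cdots$ (of even or odd length). A graph $G=(V,E)$ is word-representable if there is a word $w$ over $V$ (a word-representant) such that for all $a,b\in V$, $a$ and $b$ are adjacent iff they alternate in $w$. $\ell(G)$ denotes the minimum length of a word-representant of $G$. The clique number is the size of a largest complete subgraph. -}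

module Defs where

open import Data.Nat using (ℕ; zero; suc; _≤_)
open import Data.Fin using (Fin; _≟_)
open import Data.Bool using (Bool; true; false; _∨_; if_then_else_)
open import Data.List using (List; []; _∷_; _++_; length)
open import Data.List.Membership.Propositional using (_∈_)
open import Data.List.Relation.Unary.Unique.Propositional using (Unique)
open import Data.List.Relation.Unary.AllPairs using (AllPairs)
open import Data.List.Relation.Unary.Linked using (Linked)
open import Data.Product using (Σ; ∃; _×_)
open import Data.Sum using (_⊎_)
open import Relation.Nullary using (¬_; does)
open import Relation.Binary.PropositionalEquality using (_≡_; _≢_)

record Graph (n : ℕ) : Set₁ where
  field
    Adj   : Fin n → Fin n → Set
    sym   : ∀ {u v} → Adj u v → Adj v u
    irrefl : ∀ {u} → ¬ Adj u u
open Graph public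

data Walk {n : ℕ} (R : Fin n → Fin n → Set) : Fin n → Fin n → Set where
  here : ∀ {u} → Walk R u u
  step : ∀ {u w v} → R u w → Walk R w v → Walk R u v

Connected : {n : ℕ} → (Fin n → Fin n → Set) → Set
Connected R = ∀ u v → Walk R u v

Acyclic : {n : ℕ} → (Fin n → Fin n → Set) → Set
Acyclic R = ∀ x xs → Unique (x ∷ xs) → 3 ≤ length (x ∷ xs) →
            ¬ Linked R ((x ∷ xs) ++ (x ∷ []))

-- a tree: connected and acyclic (R is meant to be symmetric)
IsTree : {n : ℕ} → (Fin n → Fin n → Set) → Set
IsTree R = Connected R × Acyclic R

record TransitiveOrientation {n : ℕ} (G : Graph n) : Set₁ where
  field
    Arc      : Fin n → Fin n → Set
    arc-edge : ∀ {u v} → Arc u v → Adj G u v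
    edge-arc : ∀ {u v} → Adj G u v → Arc u v ⊎ Arc v u
    asym     : ∀ {u v} → Arc u v → ¬ Arc v u
    trans    : ∀ {u v w} → Arc u v → Arc v w → Arc u w
open TransitiveOrientation public

Cover : {n : ℕ} {G : Graph n} → TransitiveOrientation G → Fin n → Fin n → Set
Cover O u v = Arc O u v × ¬ (∃ λ w → Arc O u w × Arc O w v)

Hasse : {n : ℕ} {G : Graph n} → TransitiveOrientation G → Fin n → Fin n → Set
Hasse O u v = Cover O u v ⊎ Cover O v u

Treelike : {n : ℕ} {G : Graph n} → TransitiveOrientation G → Set
Treelike O = IsTree (Hasse O)

Arborescence : {n : ℕ} → Graph n → Set₁
Arborescence {n} G =
  Σ (TransitiveOrientation G) λ O → Treelike O ×
  Σ (Fin n) λ r → (∀ v → v ≢ r → Adj G r v) ×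
    ((∀ v → v ≢ r → Arc O r v) ⊎ (∀ v → v ≢ r → Arc O v r))

IsClique : {n : ℕ} → Graph n → List (Fin n) → Set
IsClique G S = Unique S × AllPairs (Adj G) S

CliqueNumber : {n : ℕ} → Graph n → ℕ → Set
CliqueNumber {n} G k =
  (Σ (List (Fin n)) λ S → IsClique G S × length S ≡ k) ×
  (∀ S → IsClique G S → length S ≤ k)

restrict : {n : ℕ} → Fin n → Fin n → List (Fin n) → List (Fin n)
restrict a b [] = []
restrict a b (x ∷ w) =
  if does (x ≟ a) ∨ does (x ≟ b) then x ∷ restrict a b w else restrict a b w

altWord : {n : ℕ} → Fin n → Fin n → ℕ → List (Fin n)
altWord a b zero = []
altWord a b (suc m) = a ∷ altWord b a m

Alternate : {n : ℕ} → Fin n → Fin n → List (Fin n) → Set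
Alternate a b w =
  ∃ λ m → restrict a b w ≡ altWord a b m ⊎ restrict a b w ≡ altWord b a m

Represents : {n : ℕ} → Graph n → List (Fin n) → Set
Represents {n} G w =
  (∀ (v : Fin n) → v ∈ w) ×
  (∀ a b → a ≢ b → (Adj G a b → Alternate a b w) × (Alternate a b w → Adj G a b))

-- Lower bound: if a and b both occur once in a word-representant w, the restriction of w to
-- them is ab or ba, so they are adjacent. Hence the letters occurring once form a clique, at most
-- k letters occur once, all others occur at least twice, and |w| ≥ 2n − k.
--
-- Upper bound: reversing the orientation if the root is a sink, the root r is the least element.
-- No vertex has two lower covers, since joining both to r by chains of covers would close a cycle
-- in the Hasse diagram. So every vertex has a unique chain of covers from r, its root path, and
-- u < v iff the root path of u is a proper prefix of that of v; adjacency is comparability, and a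
-- maximum clique S is a root path. Sort the vertices lexicographically by root paths in two ways,
-- with opposite orders on siblings and the vertices of S last among their siblings in the second
-- way, and let w be the vertices outside S in the first order followed by all vertices in the
-- second, so |w| = (n − k) + n. For a < b the restriction of w to a, b is ab, bab or abab. For
-- incomparable a, b it is abba or baab, or bba if a ∈ S and b ∉ S, so they do not alternate.

{-# OPTIONS --safe #-}
module Submission where

open import Defs hiding (sym; trans; irrefl)
open import Data.Bool using (true; false; if_then_else_; _∨_)
open import Data.Bool.Properties using (∨-comm)
open import Data.Empty using (⊥; ⊥-elim)
open import Data.Fin using (Fin; _≟_; toℕ)
open import Data.Fin.Induction using (spo-wellFounded; spo-noetherian)
open import Data.Fin.Properties using (any?; sequence; toℕ-injective; toℕ<n)
open import Data.List using (List; []; _∷_; _++_; [_]; _∷ʳ_; length; replicate; map; reverse; reverseAcc; head; allFin; filter)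
open import Data.List.Membership.Propositional using (_∈_; _∉_)
open import Data.List.Membership.Propositional.Properties using (∈-allFin; ∈-filter⁺; ∈-filter⁻; ∈-∃++; ∈-++⁺ˡ; ∈-++⁺ʳ; ∈-++⁻)
open import Data.List.Properties using (length-++; length-tabulate; map-cong; ∷-injectiveˡ; ∷-injectiveʳ; ∷ʳ-injective; ++-assoc; ++-cancelˡ; ++-identityʳ; reverse-++; unfold-reverse; reverse-involutive)
open import Data.List.Relation.Binary.Disjoint.Propositional using (Disjoint)
open import Data.List.Relation.Binary.Lex.Core using (halt; this; next)
open import Data.List.Relation.Binary.Lex.Strict using (Lex-<) renaming (<-isStrictTotalOrder to Lex-isStrictTotalOrder)
open import Data.List.Relation.Binary.Permutation.Propositional using (_↭_; ↭-sym; ↭⇒↭ₛ′)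
open import Data.List.Relation.Binary.Permutation.Propositional.Properties using (↭-reverse; ∈-resp-↭; ↭-length)
import Data.List.Relation.Binary.Permutation.Setoid.Properties as SetoidPermutation
open import Data.List.Relation.Binary.Pointwise using (Pointwise-≡⇒≡)
open import Data.List.Relation.Unary.All as All using (All; []; _∷_)
open import Data.List.Relation.Unary.All.Properties using (¬Any⇒All¬; All¬⇒¬Any) renaming (++⁻ˡ to All-++⁻ˡ)
open import Data.List.Relation.Unary.AllPairs as AllPairs using (AllPairs; []; _∷_)
open import Data.List.Relation.Unary.AllPairs.Properties using () renaming (filter⁺ to AllPairs-filter⁺)
open import Data.List.Relation.Unary.Any as Any using (Any; here; there)
open import Data.List.Relation.Unary.Any.Properties using (reverse⁺; reverse⁻)
open import Data.List.Relation.Unary.First as First using (First)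
open import Data.List.Relation.Unary.First.Properties using (toView)
open import Data.List.Relation.Unary.Linked as Linked using (Linked; []; [-]; _∷_)
open import Data.List.Relation.Unary.Linked.Properties using (Linked⇒AllPairs)
open import Data.List.Relation.Unary.Unique.Propositional using (Unique)
import Data.List.Relation.Unary.Unique.Propositional.Properties as Unique
open import Data.Maybe.Properties using (just-injective)
open import Data.Nat using (ℕ; zero; suc; _+_; _*_; _∸_; _≤_; z≤n; s≤s) renaming (_<_ to _<ℕ_)
import Data.Nat as ℕ
open import Data.Nat.ListAction using (sum)
open import Data.Nat.Properties using (+-mono-≤; ≤-trans; ≤-reflexive; m≤m+n; m≤n+m; m+n≡0⇒m≡0; m+n≡0⇒n≡0; m+n∸n≡m; ∸-mono; *-suc; *-zeroʳ; *-identityˡ; suc-injective; 1+n≰n; +-assoc; +-comm; +-identityʳ; +-cancelˡ-≡; module ≤-Reasoning) renaming (<-isStrictTotalOrder to <ℕ-isStrictTotalOrder; <-irrefl to <ℕ-irrefl)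
open import Algebra.Properties.CommutativeSemigroup Data.Nat.Properties.+-commutativeSemigroup using (interchange)
open import Data.Product using (Σ; ∃; ∃₂; _×_; _,_; proj₁; proj₂)
open import Data.Sum as Sum using (_⊎_; inj₁; inj₂; [_,_]′; swap)
open import Effect.Monad using (RawMonad)
open import Function using (_∘_; _on_; flip; id)
open import Induction.WellFounded using (Acc; acc)
open import Relation.Binary using (Decidable; IsStrictTotalOrder; IsStrictPartialOrder; DecTotalOrder; Tri; tri<; tri≈; tri>)
import Relation.Binary.Construct.Flip.EqAndOrd as Flip
import Relation.Binary.Construct.StrictToNonStrict as NonStrict
open import Relation.Binary.PropositionalEquality using (_≡_; _≢_; refl; sym; trans; cong; cong₂; subst; subst₂; setoid; isEquivalence; resp₂; module ≡-Reasoning)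
open import Relation.Nullary using (¬_; Dec; does; yes; no; ¬?; _⊎-dec_; _×-dec_)
open import Relation.Nullary.Decidable using (dec-true; dec-false; toSum; ¬¬-excluded-middle; decidable-stable)
open import Relation.Nullary.Negation using (¬¬-Monad; ¬¬-map)
open import Relation.Unary using (∁)

private variable
  A B : Set
  n : ℕ

sum-map-+ : (f g : A → ℕ) (xs : List A) →
            sum (map (λ x → f x + g x) xs) ≡ sum (map f xs) + sum (map g xs)
sum-map-+ f g [] = refl
sum-map-+ f g (x ∷ xs) = trans (cong (f x + g x +_) (sum-map-+ f g xs)) (interchange (f x) (g x) _ _)

sum-map-mono : {f g : A → ℕ} → (∀ x → f x ≤ g x) → (xs : List A) → sum (map f xs) ≤ sum (map g xs)
sum-map-mono f≤g [] = z≤n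
sum-map-mono f≤g (x ∷ xs) = +-mono-≤ (f≤g x) (sum-map-mono f≤g xs)

sum-map-const : (c : ℕ) (xs : List A) → sum (map (λ _ → c) xs) ≡ c * length xs
sum-map-const c [] = sym (*-zeroʳ c)
sum-map-const c (x ∷ xs) = trans (cong (c +_) (sum-map-const c xs)) (sym (*-suc c (length xs)))

module _ {R : A → A → Set} where

  Linked-prefix : ∀ xs {z ys} → Linked R (xs ++ z ∷ ys) → Linked R (xs ∷ʳ z)
  Linked-prefix [] _ = [-]
  Linked-prefix (x ∷ []) (r ∷ _) = r ∷ [-]
  Linked-prefix (x ∷ y ∷ xs) (r ∷ rs) = r ∷ Linked-prefix (y ∷ xs) rs

  Linked-glue : ∀ xs {z ys} → Linked R (xs ∷ʳ z) → Linked R (z ∷ ys) → Linked R (xs ++ z ∷ ys)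
  Linked-glue [] _ rs = rs
  Linked-glue (x ∷ []) (r ∷ _) rs = r ∷ rs
  Linked-glue (x ∷ y ∷ xs) (r ∷ rs′) rs = r ∷ Linked-glue (y ∷ xs) rs′ rs

  Linked-reverse : (∀ {x y} → R x y → R y x) → ∀ {xs} → Linked R xs → Linked R (reverse xs)
  Linked-reverse R-sym [] = []
  Linked-reverse R-sym {_ ∷ _} rs = go [-] rs
    where
    go : ∀ {x acc xs} → Linked R (x ∷ acc) → Linked R (x ∷ xs) → Linked R (reverseAcc (x ∷ acc) xs)
    go racc [-] = racc
    go racc (r ∷ rs) = go (R-sym r ∷ racc) rs

  AllPairs-++⁻ˡ : ∀ xs {ys} → AllPairs R (xs ++ ys) → AllPairs R xs
  AllPairs-++⁻ˡ [] _ = []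
  AllPairs-++⁻ˡ (x ∷ xs) (r ∷ rs) = All-++⁻ˡ xs r ∷ AllPairs-++⁻ˡ xs rs

AllPairs-lookup : {R : A → A → Set} → (∀ {x y} → R x y → R y x) →
                  ∀ {xs a b} → AllPairs R xs → a ∈ xs → b ∈ xs → a ≢ b → R a b
AllPairs-lookup R-sym (_ ∷ _) (here refl) (here refl) a≢b = ⊥-elim (a≢b refl)
AllPairs-lookup R-sym (Rx ∷ _) (here refl) (there b∈) _ = All.lookup Rx b∈
AllPairs-lookup R-sym (Rx ∷ _) (there a∈) (here refl) _ = R-sym (All.lookup Rx a∈)
AllPairs-lookup R-sym (_ ∷ Rxs) (there a∈) (there b∈) a≢b = AllPairs-lookup R-sym Rxs a∈ b∈ a≢b

distinct-members⇒AllPairs : {R : A → A → Set} {xs : List A} → Unique xs →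
                            (∀ {a b} → a ∈ xs → b ∈ xs → a ≢ b → R a b) → AllPairs R xs
distinct-members⇒AllPairs [] R-xs = []
distinct-members⇒AllPairs (x∉xs ∷ xs!) R-xs =
  All.tabulate (λ y∈xs → R-xs (here refl) (there y∈xs) (All.lookup x∉xs y∈xs))
  ∷ distinct-members⇒AllPairs xs! (λ a∈xs b∈xs → R-xs (there a∈xs) (there b∈xs))

Unique-resp-↭ : {xs ys : List A} → xs ↭ ys → Unique xs → Unique ys
Unique-resp-↭ {A = A} = SetoidPermutation.Unique-resp-↭ (setoid A) ∘ ↭⇒↭ₛ′ isEquivalence

Any⇒First : {P : A → Set} → (∀ x → Dec (P x)) → ∀ {xs} → Any P xs → First (∁ P) P xs
Any⇒First P? {x ∷ xs} any with P? x
... | yes px = First.[ px ]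
... | no ¬px = ¬px First.∷ Any⇒First P? (Any.tail ¬px any)

length-++-∷ : ∀ (xs : List A) {z ys} → 1 ≤ length (xs ++ z ∷ ys)
length-++-∷ [] = s≤s z≤n
length-++-∷ (x ∷ xs) = s≤s z≤n

++-∷-≢ : ∀ (xs : List A) {z zs} → xs ≢ xs ++ z ∷ zs
++-∷-≢ [] ()
++-∷-≢ (x ∷ xs) eq = ++-∷-≢ xs (∷-injectiveʳ eq)

_⊏_ : List A → List A → Set
xs ⊏ ys = ∃₂ λ z zs → ys ≡ xs ++ z ∷ zs

∷ʳ-⊏ : (xs : List A) (x : A) → [] ⊏ (xs ∷ʳ x)
∷ʳ-⊏ [] x = x , [] , refl
∷ʳ-⊏ (y ∷ ys) x = y , ys ∷ʳ x , refl

⊏-∷ : ∀ {x : A} {xs ys} → xs ⊏ ys → (x ∷ xs) ⊏ (x ∷ ys)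
⊏-∷ {x = x} (z , zs , eq) = z , zs , cong (x ∷_) eq

data Diverge (xs ys : List A) : Set where
  diverge : ∀ c {x y} xs′ ys′ → x ≢ y → xs ≡ c ++ x ∷ xs′ → ys ≡ c ++ y ∷ ys′ → Diverge xs ys

Diverge-sym : {xs ys : List A} → Diverge xs ys → Diverge ys xs
Diverge-sym (diverge c xs′ ys′ x≢y xs≡ ys≡) = diverge c ys′ xs′ (x≢y ∘ sym) ys≡ xs≡

Diverge-∷ : ∀ {x : A} {xs ys} → Diverge xs ys → Diverge (x ∷ xs) (x ∷ ys)
Diverge-∷ {x = x} (diverge c xs′ ys′ x≢y xs≡ ys≡) =
  diverge (x ∷ c) xs′ ys′ x≢y (cong (x ∷_) xs≡) (cong (x ∷_) ys≡)

Diverge⇒≢-extensions : {xs ys : List A} → Diverge xs ys → ∀ us vs → xs ++ us ≢ ys ++ vs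
Diverge⇒≢-extensions (diverge c {x} {y} xs′ ys′ x≢y refl refl) us vs eq =
  x≢y (∷-injectiveˡ (++-cancelˡ c (x ∷ xs′ ++ us) (y ∷ ys′ ++ vs)
    (trans (sym (++-assoc c (x ∷ xs′) us)) (trans eq (++-assoc c (y ∷ ys′) vs)))))

list-trichotomy : (xs ys : List (Fin n)) → xs ≡ ys ⊎ xs ⊏ ys ⊎ ys ⊏ xs ⊎ Diverge xs ys
list-trichotomy [] [] = inj₁ refl
list-trichotomy [] (y ∷ ys) = inj₂ (inj₁ (y , ys , refl))
list-trichotomy (x ∷ xs) [] = inj₂ (inj₂ (inj₁ (x , xs , refl)))
list-trichotomy (x ∷ xs) (y ∷ ys) with x ≟ y
... | no x≢y = inj₂ (inj₂ (inj₂ (diverge [] xs ys x≢y refl refl)))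
... | yes refl = Sum.map (cong (x ∷_)) (Sum.map ⊏-∷ (Sum.map ⊏-∷ Diverge-∷)) (list-trichotomy xs ys)

_∈?_ : (v : Fin n) (vs : List (Fin n)) → Dec (v ∈ vs)
v ∈? vs = Any.any? (v ≟_) vs

pullback-≡ : {_≈_ _≺_ : B → B → Set} → IsStrictTotalOrder _≈_ _≺_ →
             (f : A → B) → (∀ {x y} → f x ≈ f y → x ≡ y) → IsStrictTotalOrder _≡_ (_≺_ on f)
pullback-≡ {_≈_ = _≈_} {_≺_} sto f f-inj = record
  { isStrictPartialOrder = record
    { isEquivalence = isEquivalence
    ; irrefl = λ { refl → irrefl Eq.refl }
    ; trans = trans′
    ; <-resp-≈ = resp₂ (_≺_ on f)
    }
  ; compare = λ x y → tri (compare (f x) (f y))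
  }
  where
  open IsStrictTotalOrder sto using (irrefl; compare; module Eq) renaming (trans to trans′)
  tri : ∀ {x y} → Tri (f x ≺ f y) (f x ≈ f y) (f y ≺ f x) → Tri ((_≺_ on f) x y) (x ≡ y) ((_≺_ on f) y x)
  tri (tri< lt ¬eq ¬gt) = tri< lt (¬eq ∘ Eq.reflexive ∘ cong f) ¬gt
  tri (tri≈ ¬lt eq ¬gt) = tri≈ ¬lt (f-inj eq) ¬gt
  tri (tri> ¬lt ¬eq gt) = tri> ¬lt (¬eq ∘ Eq.reflexive ∘ cong f) gt

module _ {_≺_ : A → A → Set} where

  Lex-prefix : ∀ xs {y ys} → Lex-< _≡_ _≺_ xs (xs ++ y ∷ ys)
  Lex-prefix [] = halt
  Lex-prefix (x ∷ xs) = next refl (Lex-prefix xs)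

  Lex-diverge : ∀ c {x y xs ys} → x ≺ y → Lex-< _≡_ _≺_ (c ++ x ∷ xs) (c ++ y ∷ ys)
  Lex-diverge [] x≺y = this x≺y
  Lex-diverge (z ∷ c) x≺y = next refl (Lex-diverge c x≺y)

module StrictSort {_≺_ : A → A → Set} (≺-sto : IsStrictTotalOrder _≡_ _≺_) where

  private
    ≤-decTotalOrder : DecTotalOrder _ _ _
    ≤-decTotalOrder = record { isDecTotalOrder = NonStrict.isDecTotalOrder _≡_ _≺_ ≺-sto }
    open DecTotalOrder ≤-decTotalOrder using () renaming (trans to ≤-trans′)

  open import Data.List.Sort ≤-decTotalOrder public using (sort; sort-↭)
  open import Data.List.Sort ≤-decTotalOrder using (sort-↗)

  sort-strict : ∀ {xs} → Unique xs → AllPairs _≺_ (sort xs)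
  sort-strict {xs} xs! =
    AllPairs.zipWith strict (Linked⇒AllPairs ≤-trans′ (sort-↗ xs) , Unique-resp-↭ (↭-sym (sort-↭ xs)) xs!)
    where
    strict : ∀ {x y} → (x ≺ y ⊎ x ≡ y) × x ≢ y → x ≺ y
    strict (inj₁ x≺y , _) = x≺y
    strict (inj₂ x≡y , x≢y) = ⊥-elim (x≢y x≡y)

δ : Fin n → Fin n → ℕ
δ x v = if does (x ≟ v) then 1 else 0

δ-refl : (x : Fin n) → δ x x ≡ 1
δ-refl x rewrite dec-true (x ≟ x) refl = refl

δ-≢ : {x v : Fin n} → x ≢ v → δ x v ≡ 0
δ-≢ {x = x} {v} x≢v rewrite dec-false (x ≟ v) x≢v = refl

δ-comm : (x v : Fin n) → δ x v ≡ δ v x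
δ-comm x v =
  [ (λ { refl → refl }) , (λ x≢v → trans (δ-≢ x≢v) (sym (δ-≢ (x≢v ∘ sym)))) ]′ (toSum (x ≟ v))

count : Fin n → List (Fin n) → ℕ
count v w = sum (map (λ x → δ x v) w)

count-∉ : {v : Fin n} (w : List (Fin n)) → v ∉ w → count v w ≡ 0
count-∉ [] v∉w = refl
count-∉ (x ∷ w) v∉w = cong₂ _+_ (δ-≢ (v∉w ∘ here ∘ sym)) (count-∉ w (v∉w ∘ there))

count-unique : {v : Fin n} {w : List (Fin n)} → Unique w → v ∈ w → count v w ≡ 1
count-unique {w = x ∷ w} (x∉w ∷ _) (here refl) =
  cong₂ _+_ (δ-refl x) (count-∉ w (λ x∈w → All.lookup x∉w x∈w refl))
count-unique {w = x ∷ w} (x∉w ∷ w!) (there v∈w) =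
  cong₂ _+_ (δ-≢ (All.lookup x∉w v∈w)) (count-unique w! v∈w)

count-∈ : {v : Fin n} {w : List (Fin n)} → v ∈ w → 1 ≤ count v w
count-∈ {w = x ∷ w} (here refl) = subst (λ d → 1 ≤ d + count x w) (sym (δ-refl x)) (s≤s z≤n)
count-∈ {v = v} {x ∷ w} (there v∈w) = ≤-trans (count-∈ v∈w) (m≤n+m (count v w) (δ x v))

∑ : (Fin n → ℕ) → ℕ
∑ {n} f = sum (map f (allFin n))

∑-const : (c : ℕ) → ∑ {n} (λ _ → c) ≡ c * n
∑-const {n} c = trans (sum-map-const c (allFin n)) (cong (c *_) (length-tabulate {n = n} id))

length≡∑count : (w : List (Fin n)) → length w ≡ ∑ (λ v → count v w)
length≡∑count {n} [] = sym (∑-const {n} 0)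
length≡∑count {n} (x ∷ w) = sym (begin
  ∑ (λ v → δ x v + count v w)          ≡⟨ sum-map-+ (δ x) (λ v → count v w) (allFin n) ⟩
  ∑ (δ x) + ∑ (λ v → count v w)        ≡⟨ cong₂ _+_ ∑δ≡1 (sym (length≡∑count w)) ⟩
  suc (length w)                       ∎)
  where
  open ≡-Reasoning
  ∑δ≡1 : ∑ (δ x) ≡ 1
  ∑δ≡1 = trans (cong sum (map-cong (δ-comm x) (allFin n))) (count-unique (Unique.allFin⁺ n) (∈-allFin x))

complement-length : {F S : List (Fin n)} → Unique F → Unique S →
                    (∀ {v} → v ∉ S → v ∈ F) → (∀ {v} → v ∈ S → v ∉ F) → length F + length S ≡ n
complement-length {n} {F} {S} F! S! ∉S⇒∈F ∈S⇒∉F = begin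
  length F + length S                          ≡⟨ cong₂ _+_ (length≡∑count F) (length≡∑count S) ⟩
  ∑ (λ v → count v F) + ∑ (λ v → count v S)    ≡⟨ sum-map-+ (λ v → count v F) (λ v → count v S) (allFin n) ⟨
  ∑ (λ v → count v F + count v S)              ≡⟨ cong sum (map-cong exactly-once (allFin n)) ⟩
  ∑ (λ (_ : Fin n) → 1)                        ≡⟨ ∑-const 1 ⟩
  1 * n                                        ≡⟨ *-identityˡ n ⟩
  n                                            ∎
  where
  open ≡-Reasoning
  exactly-once : ∀ v → count v F + count v S ≡ 1
  exactly-once v with v ∈? S
  ... | yes v∈S = cong₂ _+_ (count-∉ F (∈S⇒∉F v∈S)) (count-unique S! v∈S)
  ... | no v∉S = cong₂ _+_ (count-unique F! (∉S⇒∈F v∉S)) (count-∉ S v∉S)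

restrict-keep : {a b x : Fin n} (w : List (Fin n)) → x ≡ a ⊎ x ≡ b → restrict a b (x ∷ w) ≡ x ∷ restrict a b w
restrict-keep {a = a} {b} {x} w x∈ab =
  cong (if_then x ∷ restrict a b w else restrict a b w) (dec-true (x ≟ a ⊎-dec x ≟ b) x∈ab)

restrict-drop : {a b x : Fin n} (w : List (Fin n)) → x ≢ a → x ≢ b → restrict a b (x ∷ w) ≡ restrict a b w
restrict-drop {a = a} {b} {x} w x≢a x≢b =
  cong (if_then x ∷ restrict a b w else restrict a b w) (dec-false (x ≟ a ⊎-dec x ≟ b) [ x≢a , x≢b ]′)

restrict-++ : (a b : Fin n) (xs ys : List (Fin n)) → restrict a b (xs ++ ys) ≡ restrict a b xs ++ restrict a b ys
restrict-++ a b [] ys = refl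
restrict-++ a b (x ∷ xs) ys with does (x ≟ a) ∨ does (x ≟ b)
... | true = cong (x ∷_) (restrict-++ a b xs ys)
... | false = restrict-++ a b xs ys

restrict-comm : (a b : Fin n) (w : List (Fin n)) → restrict a b w ≡ restrict b a w
restrict-comm a b [] = refl
restrict-comm a b (x ∷ w) rewrite ∨-comm (does (x ≟ a)) (does (x ≟ b)) | restrict-comm a b w = refl

restrict-⊆ : (a b : Fin n) (w : List (Fin n)) → All (λ x → x ≡ a ⊎ x ≡ b) (restrict a b w)
restrict-⊆ a b [] = []
restrict-⊆ a b (x ∷ w) with x ≟ a ⊎-dec x ≟ b
... | yes x∈ab = subst (All _) (sym (restrict-keep w x∈ab)) (x∈ab ∷ restrict-⊆ a b w)
... | no x∉ab = subst (All _) (sym (restrict-drop w (x∉ab ∘ inj₁) (x∉ab ∘ inj₂))) (restrict-⊆ a b w)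

count-restrict : (a b : Fin n) (w : List (Fin n)) → count a (restrict a b w) ≡ count a w
count-restrict a b [] = refl
count-restrict a b (x ∷ w) with x ≟ a ⊎-dec x ≟ b
... | yes x∈ab = trans (cong (count a) (restrict-keep w x∈ab)) (cong (δ x a +_) (count-restrict a b w))
... | no x∉ab = begin
  count a (restrict a b (x ∷ w))  ≡⟨ cong (count a) (restrict-drop w (x∉ab ∘ inj₁) (x∉ab ∘ inj₂)) ⟩
  count a (restrict a b w)        ≡⟨ count-restrict a b w ⟩
  count a w                       ≡⟨ cong (_+ count a w) (δ-≢ (x∉ab ∘ inj₁)) ⟨
  count a (x ∷ w)                 ∎
  where open ≡-Reasoning

restrict-∉ : {a b : Fin n} (w : List (Fin n)) → a ∉ w → b ∉ w → restrict a b w ≡ []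
restrict-∉ [] a∉w b∉w = refl
restrict-∉ (x ∷ w) a∉w b∉w =
  trans (restrict-drop w (a∉w ∘ here ∘ sym) (b∉w ∘ here ∘ sym)) (restrict-∉ w (a∉w ∘ there) (b∉w ∘ there))

restrict-single : {a b : Fin n} {w : List (Fin n)} → Unique w → a ∈ w → b ∉ w → restrict a b w ≡ [ a ]
restrict-single {a = a} {w = x ∷ w} (x∉w ∷ _) (here refl) b∉w =
  trans (restrict-keep w (inj₁ refl))
        (cong (a ∷_) (restrict-∉ w (λ a∈w → All.lookup x∉w a∈w refl) (b∉w ∘ there)))
restrict-single {w = x ∷ w} (x∉w ∷ w!) (there a∈w) b∉w =
  trans (restrict-drop w (All.lookup x∉w a∈w) (b∉w ∘ here ∘ sym)) (restrict-single w! a∈w (b∉w ∘ there))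

module _ {_≺_ : Fin n → Fin n → Set} (≺-asym : ∀ {x y} → x ≺ y → ¬ y ≺ x) where

  ≺⇒≢ : ∀ {x y} → x ≺ y → x ≢ y
  ≺⇒≢ x≺y refl = ≺-asym x≺y x≺y

  AllPairs⇒Unique : ∀ {w} → AllPairs _≺_ w → Unique w
  AllPairs⇒Unique = AllPairs.map ≺⇒≢

  restrict-sorted : ∀ {a b w} → AllPairs _≺_ w → a ∈ w → b ∈ w → a ≺ b → restrict a b w ≡ a ∷ b ∷ []
  restrict-sorted (_ ∷ _) (here refl) (here refl) a≺b = ⊥-elim (≺⇒≢ a≺b refl)
  restrict-sorted {a} {b} {x ∷ w} (x≺w ∷ ≺w) (here refl) (there b∈w) a≺b =
    trans (restrict-keep w (inj₁ refl))
          (cong (a ∷_) (trans (restrict-comm a b w)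
                              (restrict-single (AllPairs⇒Unique ≺w) b∈w (λ a∈w → ≺⇒≢ (All.lookup x≺w a∈w) refl))))
  restrict-sorted (x≺w ∷ _) (there a∈w) (here refl) a≺b = ⊥-elim (≺-asym a≺b (All.lookup x≺w a∈w))
  restrict-sorted {w = x ∷ w} (x≺w ∷ ≺w) (there a∈w) (there b∈w) a≺b =
    trans (restrict-drop w (≺⇒≢ (All.lookup x≺w a∈w)) (≺⇒≢ (All.lookup x≺w b∈w)))
          (restrict-sorted ≺w a∈w b∈w a≺b)

altWord-square-free : {a b x : Fin n} → a ≢ b → ∀ m xs {ys} → altWord a b m ≢ xs ++ x ∷ x ∷ ys
altWord-square-free a≢b zero [] ()
altWord-square-free a≢b zero (_ ∷ _) ()
altWord-square-free a≢b (suc zero) [] ()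
altWord-square-free a≢b (suc (suc m)) [] refl = a≢b refl
altWord-square-free a≢b (suc m) (_ ∷ xs) eq = altWord-square-free (a≢b ∘ sym) m xs (∷-injectiveʳ eq)

¬Alternate-square : {a b x : Fin n} {w : List (Fin n)} → a ≢ b →
                    ∀ xs {ys} → restrict a b w ≡ xs ++ x ∷ x ∷ ys → ¬ Alternate a b w
¬Alternate-square a≢b xs eq (m , inj₁ alt) = altWord-square-free a≢b m xs (trans (sym alt) eq)
¬Alternate-square a≢b xs eq (m , inj₂ alt) = altWord-square-free (a≢b ∘ sym) m xs (trans (sym alt) eq)

Alternate-comm : {a b : Fin n} {w : List (Fin n)} → Alternate a b w → Alternate b a w
Alternate-comm {a = a} {b} {w} (m , alt) = m , swap (Sum.map (trans (restrict-comm b a w)) (trans (restrict-comm b a w)) alt)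

one-letter : {a b : Fin n} {u : List (Fin n)} → All (λ x → x ≡ a ⊎ x ≡ b) u → count a u ≡ 0 →
             u ≡ replicate (count b u) b
one-letter [] _ = refl
one-letter {a = a} (inj₁ refl ∷ _) ca with () ← trans (sym (δ-refl a)) (m+n≡0⇒m≡0 _ ca)
one-letter {a = a} {b} {b ∷ u} (inj₂ refl ∷ ab-u) ca =
  trans (cong (b ∷_) (one-letter ab-u (m+n≡0⇒n≡0 (δ b a) ca)))
        (cong (λ d → replicate (d + count b u) b) (sym (δ-refl b)))

first-of-two : {a b : Fin n} {u : List (Fin n)} → a ≢ b → All (λ x → x ≡ a ⊎ x ≡ b) u →
               count a (a ∷ u) ≡ 1 → count b (a ∷ u) ≡ 1 → u ≡ b ∷ []
first-of-two {a = a} {b} {u} a≢b ab-u ca cb = begin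
  u                          ≡⟨ one-letter ab-u (suc-injective (trans (cong (_+ count a u) (sym (δ-refl a))) ca)) ⟩
  replicate (count b u) b    ≡⟨ cong (λ m → replicate m b) (trans (cong (_+ count b u) (sym (δ-≢ a≢b))) cb) ⟩
  b ∷ []                     ∎
  where open ≡-Reasoning

two-letters : {a b : Fin n} {u : List (Fin n)} → a ≢ b → All (λ x → x ≡ a ⊎ x ≡ b) u →
              count a u ≡ 1 → count b u ≡ 1 → u ≡ a ∷ b ∷ [] ⊎ u ≡ b ∷ a ∷ []
two-letters {u = []} a≢b _ () _
two-letters {a = a} {u = a ∷ u} a≢b (inj₁ refl ∷ ab-u) ca cb = inj₁ (cong (a ∷_) (first-of-two a≢b ab-u ca cb))
two-letters {b = b} {u = b ∷ u} a≢b (inj₂ refl ∷ ab-u) ca cb =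
  inj₂ (cong (b ∷_) (first-of-two (a≢b ∘ sym) (All.map swap ab-u) cb ca))

Alternate-once : {a b : Fin n} {w : List (Fin n)} → a ≢ b → count a w ≡ 1 → count b w ≡ 1 → Alternate a b w
Alternate-once {a = a} {b} {w} a≢b ca cb = 2 , two-letters a≢b (restrict-⊆ a b w) ca′ cb′
  where
  ca′ : count a (restrict a b w) ≡ 1
  ca′ = trans (count-restrict a b w) ca
  cb′ : count b (restrict a b w) ≡ 1
  cb′ = trans (cong (count b) (restrict-comm a b w)) (trans (count-restrict b a w) cb)

-- The lower bound

occurs-once? : (w : List (Fin n)) (v : Fin n) → Dec (count v w ≡ 1)
occurs-once? w v = count v w ℕ.≟ 1

singletons : List (Fin n) → List (Fin n)
singletons w = filter (occurs-once? w) (allFin _)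

module _ {w : List (Fin n)} where

  singletons-unique : Unique (singletons w)
  singletons-unique = Unique.filter⁺ (occurs-once? w) (Unique.allFin⁺ n)

  ∈-singletons⁻ : ∀ {v} → v ∈ singletons w → count v w ≡ 1
  ∈-singletons⁻ = proj₂ ∘ ∈-filter⁻ (occurs-once? w) {xs = allFin n}

  singletons-clique : (G : Graph n) → Represents G w → IsClique G (singletons w)
  singletons-clique G (_ , adj⇔alt) = singletons-unique , distinct-members⇒AllPairs singletons-unique adjacent
    where
    adjacent : ∀ {a b} → a ∈ singletons w → b ∈ singletons w → a ≢ b → Adj G a b
    adjacent {a} {b} a∈ b∈ a≢b =
      proj₂ (adj⇔alt a b a≢b) (Alternate-once {w = w} a≢b (∈-singletons⁻ a∈) (∈-singletons⁻ b∈))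

  length-singletons : (∀ v → v ∈ w) → 2 * n ≤ length w + length (singletons w)
  length-singletons ∈w = begin
    2 * n                                          ≡⟨ ∑-const {n} 2 ⟨
    ∑ (λ (_ : Fin n) → 2)                         ≤⟨ sum-map-mono twice (allFin n) ⟩
    ∑ (λ v → count v w + count v (singletons w))   ≡⟨ sum-map-+ (λ v → count v w) (λ v → count v (singletons w)) (allFin n) ⟩
    ∑ (λ v → count v w) + ∑ (λ v → count v (singletons w))
                                                   ≡⟨ cong₂ _+_ (length≡∑count w) (length≡∑count (singletons w)) ⟨
    length w + length (singletons w)               ∎
    where
    open ≤-Reasoning
    twice : ∀ v → 2 ≤ count v w + count v (singletons w)
    twice v with occurs-once? w v
    ... | yes once rewrite once =
      s≤s (≤-reflexive (sym (count-unique singletons-unique (∈-filter⁺ (occurs-once? w) (∈-allFin v) once))))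
    ... | no ¬once = ≤-trans (at-least-two (count-∈ (∈w v)) ¬once) (m≤m+n _ _)
      where
      at-least-two : ∀ {m} → 1 ≤ m → m ≢ 1 → 2 ≤ m
      at-least-two {suc zero} _ m≢1 = ⊥-elim (m≢1 refl)
      at-least-two {suc (suc _)} _ _ = s≤s (s≤s z≤n)

lower-bound : (G : Graph n) (k : ℕ) → (∀ S → IsClique G S → length S ≤ k) →
              (w : List (Fin n)) → Represents G w → 2 * n ∸ k ≤ length w
lower-bound {n} G k clique≤k w rep@(∈w , _) = begin
  2 * n ∸ k                                            ≤⟨ ∸-mono (length-singletons ∈w) (clique≤k _ (singletons-clique G rep)) ⟩
  length w + length (singletons w) ∸ length (singletons w) ≡⟨ m+n∸n≡m (length w) (length (singletons w)) ⟩
  length w                                             ∎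
  where open ≤-Reasoning

-- Acyclic graphs and arborescences

walk-map : {P Q : Fin n → Fin n → Set} → (∀ {x y} → P x y → Q x y) → ∀ {u v} → Walk P u v → Walk Q u v
walk-map P⇒Q here = here
walk-map P⇒Q (step p w) = step (P⇒Q p) (walk-map P⇒Q w)

module _ {H : Fin n → Fin n → Set} (H-sym : ∀ {x y} → H x y → H y x) (acyclic : Acyclic H) where

  private
    ¬internally-disjoint-paths : ∀ {x z} Dp {D″} Ep {E″} →
                                 Linked H (x ∷ Dp ++ z ∷ D″) → Unique (x ∷ Dp ++ z ∷ D″) →
                                 Linked H (x ∷ Ep ++ z ∷ E″) → Unique (x ∷ Ep ++ z ∷ E″) →
                                 All (_∉ Ep ++ z ∷ E″) Dp → 3 ≤ length (x ∷ Dp ++ z ∷ reverse Ep) → ⊥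
    ¬internally-disjoint-paths {x} {z} Dp Ep {E″} LD (x∉D ∷ D!) LE (x∉E ∷ E!) Dp∉E long =
      acyclic x (Dp ++ z ∷ reverse Ep) (¬Any⇒All¬ _ x∉cycle ∷ Unique.++⁺ Dp! zEp! disjoint) long linked
      where
      ∈E : ∀ {v} → v ∈ z ∷ reverse Ep → v ∈ Ep ++ z ∷ E″
      ∈E (here refl) = ∈-++⁺ʳ Ep (here refl)
      ∈E (there v∈) = ∈-++⁺ˡ (reverse⁻ {xs = Ep} v∈)
      x∉cycle : x ∉ Dp ++ z ∷ reverse Ep
      x∉cycle x∈ with ∈-++⁻ Dp x∈
      ... | inj₁ x∈Dp = All¬⇒¬Any x∉D (∈-++⁺ˡ x∈Dp)
      ... | inj₂ x∈ = All¬⇒¬Any x∉E (∈E x∈)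
      Dp! : Unique Dp
      Dp! = AllPairs-++⁻ˡ Dp D!
      zEp! : Unique (z ∷ reverse Ep)
      zEp! = subst Unique (reverse-++ Ep [ z ])
               (Unique-resp-↭ (↭-sym (↭-reverse (Ep ∷ʳ z)))
                 (AllPairs-++⁻ˡ (Ep ∷ʳ z) (subst Unique (sym (++-assoc Ep [ z ] E″)) E!)))
      disjoint : Disjoint Dp (z ∷ reverse Ep)
      disjoint (v∈Dp , v∈) = All.lookup Dp∉E v∈Dp (∈E v∈)
      back : Linked H (z ∷ reverse Ep ++ [ x ])
      back = subst (Linked H) (trans (reverse-++ (x ∷ Ep) [ z ]) (cong (z ∷_) (unfold-reverse x Ep)))
                   (Linked-reverse H-sym (Linked-prefix (x ∷ Ep) LE))
      linked : Linked H ((x ∷ Dp ++ z ∷ reverse Ep) ++ [ x ])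
      linked = subst (λ l → Linked H (x ∷ l)) (sym (++-assoc Dp (z ∷ reverse Ep) [ x ]))
                     (Linked-glue (x ∷ Dp) (Linked-prefix (x ∷ Dp) LD) back)

  meeting-paths-share-first-step : ∀ {x D E} → Linked H (x ∷ D) → Unique (x ∷ D) →
                                   Linked H (x ∷ E) → Unique (x ∷ E) → Any (_∈ E) D → head D ≡ head E
  meeting-paths-share-first-step {x} {E = E} LD UD LE UE meet with toView (Any⇒First (_∈? E) meet)
  ... | First._++_∷_ {Dp} {z} Dp∉E z∈E D″ with ∈-∃++ z∈E
  ...   | Ep , E″ , refl = first-steps Dp Ep Dp∉E LD UD LE UE
    where
    first-steps : ∀ Dp Ep → All (_∉ Ep ++ z ∷ E″) Dp →
                  Linked H (x ∷ Dp ++ z ∷ D″) → Unique (x ∷ Dp ++ z ∷ D″) →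
                  Linked H (x ∷ Ep ++ z ∷ E″) → Unique (x ∷ Ep ++ z ∷ E″) →
                  head (Dp ++ z ∷ D″) ≡ head (Ep ++ z ∷ E″)
    first-steps [] [] _ _ _ _ _ = refl
    first-steps (d ∷ Dp) Ep Dp∉E LD UD LE UE =
      ⊥-elim (¬internally-disjoint-paths (d ∷ Dp) Ep LD UD LE UE Dp∉E (s≤s (s≤s (length-++-∷ Dp))))
    first-steps [] (e ∷ Ep) Dp∉E LD UD LE UE =
      ⊥-elim (¬internally-disjoint-paths [] (e ∷ Ep) LD UD LE UE Dp∉E
               (s≤s (s≤s (subst (λ l → 1 ≤ length l) (sym (unfold-reverse e Ep)) (length-++-∷ (reverse Ep))))))

module _ {G : Graph n} where

  reverse-orientation : TransitiveOrientation G → TransitiveOrientation G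
  reverse-orientation O = record
    { Arc = flip (Arc O)
    ; arc-edge = Graph.sym G ∘ arc-edge O
    ; edge-arc = Sum.swap ∘ edge-arc O
    ; asym = asym O
    ; trans = flip (TransitiveOrientation.trans O)
    }

  Hasse-reverse : (O : TransitiveOrientation G) → ∀ {u v} → Hasse (reverse-orientation O) u v → Hasse O u v
  Hasse-reverse O = Sum.swap ∘ Sum.map cover-reverse cover-reverse
    where
    cover-reverse : ∀ {u v} → Cover (reverse-orientation O) u v → Cover O v u
    cover-reverse (vu , no-between) = vu , λ (w , vw , wu) → no-between (w , wu , vw)

  Treelike-reverse : (O : TransitiveOrientation G) → Treelike O → Treelike (reverse-orientation O)
  Treelike-reverse O (connected , acyclic) =
    (λ u v → walk-map (Hasse-reverse (reverse-orientation O)) (connected u v)) ,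
    (λ x xs x∷xs! long cycle → acyclic x xs x∷xs! long (Linked.map (Hasse-reverse O) cycle))

  record SourceRooted : Set₁ where
    field
      orientation : TransitiveOrientation G
      treelike : Treelike orientation
      root : Fin n
      root-least : ∀ v → v ≢ root → Arc orientation root v

  source-rooted : Arborescence G → SourceRooted
  source-rooted (O , treelike , r , _ , inj₁ source) = record
    { orientation = O ; treelike = treelike ; root = r ; root-least = source }
  source-rooted (O , treelike , r , _ , inj₂ sink) = record
    { orientation = reverse-orientation O ; treelike = Treelike-reverse O treelike ; root = r ; root-least = sink }

-- Rooted trees

¬¬-decidable : (R : Fin n → Fin n → Set) → ¬ ¬ Decidable R
¬¬-decidable R = sequence rawApplicative (λ u → sequence rawApplicative (λ v → ¬¬-excluded-middle))
  where open RawMonad ¬¬-Monad using (rawApplicative)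

record PathEncoding (_<_ : Fin n → Fin n → Set) : Set where
  field
    path : Fin n → List (Fin n)
    path-last : ∀ v → ∃ λ p → path v ≡ p ∷ʳ v
    <⇒⊏ : ∀ {u v} → u < v → path u ⊏ path v
    ⊏⇒< : ∀ {u v} → path u ⊏ path v → u < v
    prefix-closed : ∀ {v} p {x} q → path v ≡ p ++ x ∷ q → path x ≡ p ∷ʳ x

module RootedTree {G : Graph n} (T : SourceRooted {G = G}) where
  open SourceRooted T

  _<_ : Fin n → Fin n → Set
  _<_ = Arc orientation

  <-irrefl : ∀ {u} → ¬ u < u
  <-irrefl u<u = asym orientation u<u u<u

  ≮root : ∀ {u} → ¬ u < root
  ≮root {u} u<r with u ≟ root
  ... | yes refl = <-irrefl u<r
  ... | no u≢r = asym orientation u<r (root-least u u≢r)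

  -- Chain v ps: covers root ⋖ ⋯ ⋖ v, where ps lists the vertices below v downwards.
  data Chain : Fin n → List (Fin n) → Set where
    [root] : Chain root []
    _◂_ : ∀ {p v ps} → Cover orientation p v → Chain p ps → Chain v (p ∷ ps)

  chain-covers : ∀ {v ps} → Chain v ps → Linked (flip (Cover orientation)) (v ∷ ps)
  chain-covers [root] = [-]
  chain-covers (c ◂ [root]) = c ∷ [-]
  chain-covers (c ◂ (c′ ◂ d)) = c ∷ chain-covers (c′ ◂ d)

  chain-descending : ∀ {v ps} → Chain v ps → AllPairs (flip _<_) (v ∷ ps)
  chain-descending = Linked⇒AllPairs (flip (TransitiveOrientation.trans orientation)) ∘ Linked.map proj₁ ∘ chain-covers

  chain⇒Unique : ∀ {v ps} → Chain v ps → Unique (v ∷ ps)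
  chain⇒Unique = AllPairs.map (λ { y<x refl → <-irrefl y<x }) ∘ chain-descending

  root∈chain : ∀ {v ps} → Chain v ps → root ∈ v ∷ ps
  root∈chain [root] = here refl
  root∈chain (_ ◂ d) = there (root∈chain d)

  chain-suffix : ∀ pre {v ps x post} → Chain v ps → v ∷ ps ≡ pre ++ x ∷ post → Chain x post
  chain-suffix [] d refl = d
  chain-suffix (_ ∷ pre) (_ ◂ d) eq = chain-suffix pre d (∷-injectiveʳ eq)
  chain-suffix (_ ∷ []) [root] ()
  chain-suffix (_ ∷ _ ∷ _) [root] ()

  -- The order is not known to be decidable, but every relation on Fin n is decidable up to double
  -- negation; the facts derived under that assumption below are decidable, hence stable.
  module WithDecidable (_<?_ : Decidable _<_) where

    <-isStrictPartialOrder : IsStrictPartialOrder _≡_ _<_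
    <-isStrictPartialOrder = record
      { isEquivalence = isEquivalence
      ; irrefl = λ { refl → <-irrefl }
      ; trans = TransitiveOrientation.trans orientation
      ; <-resp-≈ = resp₂ _<_
      }

    cover-between : ∀ {u v} → u < v → ∃ λ q → (u ≡ q ⊎ u < q) × Cover orientation q v
    cover-between {u} {v} u<v = climb u (spo-noetherian <-isStrictPartialOrder u) (inj₁ refl) u<v
      where
      climb : ∀ p → Acc (flip _<_) p → u ≡ p ⊎ u < p → p < v →
              ∃ λ q → (u ≡ q ⊎ u < q) × Cover orientation q v
      climb p (acc above) u≤p p<v with any? (λ w → p <? w ×-dec w <? v)
      ... | no nothing-between = p , u≤p , p<v , nothing-between
      ... | yes (w , p<w , w<v) = climb w (above p<w) (inj₂ (u≤w u≤p)) w<v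
        where
        u≤w : u ≡ p ⊎ u < p → u < w
        u≤w (inj₁ refl) = p<w
        u≤w (inj₂ u<p) = TransitiveOrientation.trans orientation u<p p<w

    chain-by-descent : ∀ v → ∃ (Chain v)
    chain-by-descent v = descend v (spo-wellFounded <-isStrictPartialOrder v)
      where
      descend : ∀ v → Acc _<_ v → ∃ (Chain v)
      descend v (acc below) with v ≟ root
      ... | yes refl = [] , [root]
      ... | no v≢r with cover-between (root-least v v≢r)
      ...   | q , _ , q⋖v = let (qs , dq) = descend q (below (proj₁ q⋖v)) in q ∷ qs , q⋖v ◂ dq

    lower-cover-unique : ∀ {a c t} → Cover orientation a t → Cover orientation c t → a ≡ c
    lower-cover-unique {a} {c} {t} a⋖t c⋖t =
      just-injective (meeting-paths-share-first-step Hasse-sym (proj₂ treelike)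
        (Linked.map inj₂ (chain-covers ta)) (chain⇒Unique ta)
        (Linked.map inj₂ (chain-covers tc)) (chain⇒Unique tc)
        (Any.map (λ { refl → root∈chain (proj₂ (chain-by-descent c)) }) (root∈chain (proj₂ (chain-by-descent a)))))
      where
      ta : Chain t (a ∷ proj₁ (chain-by-descent a))
      ta = a⋖t ◂ proj₂ (chain-by-descent a)
      tc : Chain t (c ∷ proj₁ (chain-by-descent c))
      tc = c⋖t ◂ proj₂ (chain-by-descent c)
      Hasse-sym : ∀ {x y} → Hasse orientation x y → Hasse orientation y x
      Hasse-sym = Sum.swap

    chain-complete : ∀ {u v ps} → Chain v ps → u < v → u ∈ ps
    chain-complete [root] u<r = ⊥-elim (≮root u<r)
    chain-complete (p⋖v ◂ d) u<v with cover-between u<v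
    ... | q , u≤q , q⋖v with lower-cover-unique q⋖v p⋖v
    ...   | refl = Sum.[ here , there ∘ chain-complete d ]′ u≤q

  lower-cover-unique : ∀ {a c t} → Cover orientation a t → Cover orientation c t → a ≡ c
  lower-cover-unique {a} {c} a⋖t c⋖t =
    decidable-stable (a ≟ c) (¬¬-map (λ _<?_ → WithDecidable.lower-cover-unique _<?_ a⋖t c⋖t) (¬¬-decidable _<_))

  chain-complete : ∀ {u v ps} → Chain v ps → u < v → u ∈ ps
  chain-complete {u} {ps = ps} d u<v =
    decidable-stable (u ∈? ps) (¬¬-map (λ _<?_ → WithDecidable.chain-complete _<?_ d u<v) (¬¬-decidable _<_))

  cross : ∀ {x y xs} → Chain x xs → Hasse orientation x y → ∃ (Chain y)
  cross d (inj₁ x⋖y) = _ , x⋖y ◂ d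
  cross [root] (inj₂ y⋖r) = ⊥-elim (≮root (proj₁ y⋖r))
  cross (p⋖x ◂ d) (inj₂ y⋖x) with lower-cover-unique p⋖x y⋖x
  ... | refl = _ , d

  follow : ∀ {x y xs} → Chain x xs → Walk (Hasse orientation) x y → ∃ (Chain y)
  follow d here = _ , d
  follow d (step h w) = follow (proj₂ (cross d h)) w

  -- Following a Hasse walk from the root avoids the well-founded descent, which needs decidability.
  chain : ∀ v → ∃ (Chain v)
  chain v = follow [root] (proj₁ treelike root v)

  chains-equal : ∀ {v ps qs} → Chain v ps → Chain v qs → ps ≡ qs
  chains-equal [root] [root] = refl
  chains-equal [root] (p⋖r ◂ _) = ⊥-elim (≮root (proj₁ p⋖r))
  chains-equal (p⋖r ◂ _) [root] = ⊥-elim (≮root (proj₁ p⋖r))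
  chains-equal (p⋖v ◂ dp) (q⋖v ◂ dq) with lower-cover-unique p⋖v q⋖v
  ... | refl = cong (_ ∷_) (chains-equal dp dq)

  ancestors : Fin n → List (Fin n)
  ancestors v = proj₁ (chain v)

  ancestors-suffix : ∀ pre {v x post} → v ∷ ancestors v ≡ pre ++ x ∷ post → ancestors x ≡ post
  ancestors-suffix pre {v} eq = chains-equal (proj₂ (chain _)) (chain-suffix pre (proj₂ (chain v)) eq)

  path : Fin n → List (Fin n)
  path v = reverse (v ∷ ancestors v)

  <⇒⊏ : ∀ {u v} → u < v → path u ⊏ path v
  <⇒⊏ {u} {v} u<v with ∈-∃++ (chain-complete (proj₂ (chain v)) u<v)
  ... | pre , post , anc-v with ∷ʳ-⊏ (reverse pre) v
  ...   | z , zs , v-side = z , zs , (begin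
    path v                                  ≡⟨ cong (reverse ∘ (v ∷_)) anc-v ⟩
    reverse ((v ∷ pre) ++ u ∷ post)         ≡⟨ cong (λ a → reverse ((v ∷ pre) ++ u ∷ a)) u-side ⟨
    reverse ((v ∷ pre) ++ u ∷ ancestors u)  ≡⟨ reverse-++ (v ∷ pre) (u ∷ ancestors u) ⟩
    path u ++ reverse (v ∷ pre)             ≡⟨ cong (path u ++_) (trans (unfold-reverse v pre) v-side) ⟩
    path u ++ z ∷ zs                        ∎)
    where
    open ≡-Reasoning
    u-side : ancestors u ≡ post
    u-side = ancestors-suffix (v ∷ pre) (cong (v ∷_) anc-v)

  ⊏⇒< : ∀ {u v} → path u ⊏ path v → u < v
  ⊏⇒< {u} {v} (z , zs , eq)
    with reverse⁻ {xs = v ∷ ancestors v} (subst (u ∈_) (sym eq) (∈-++⁺ˡ (reverse⁺ {xs = u ∷ ancestors u} (here refl))))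
  ... | here refl = ⊥-elim (++-∷-≢ (path u) eq)
  ... | there u∈anc = All.lookup (AllPairs.head (chain-descending (proj₂ (chain v)))) u∈anc

  prefix-closed : ∀ {v} p {x} q → path v ≡ p ++ x ∷ q → path x ≡ p ∷ʳ x
  prefix-closed {v} p {x} q eq = begin
    reverse (x ∷ ancestors x)   ≡⟨ cong (reverse ∘ (x ∷_)) (ancestors-suffix (reverse q) v-side) ⟩
    reverse (x ∷ reverse p)     ≡⟨ unfold-reverse x (reverse p) ⟩
    reverse (reverse p) ∷ʳ x    ≡⟨ cong (_∷ʳ x) (reverse-involutive p) ⟩
    p ∷ʳ x                      ∎
    where
    open ≡-Reasoning
    v-side : v ∷ ancestors v ≡ reverse q ++ x ∷ reverse p
    v-side = begin
      v ∷ ancestors v                ≡⟨ reverse-involutive (v ∷ ancestors v) ⟨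
      reverse (path v)               ≡⟨ cong reverse eq ⟩
      reverse (p ++ x ∷ q)           ≡⟨ reverse-++ p (x ∷ q) ⟩
      reverse (x ∷ q) ++ reverse p   ≡⟨ cong (_++ reverse p) (unfold-reverse x q) ⟩
      (reverse q ∷ʳ x) ++ reverse p  ≡⟨ ++-assoc (reverse q) [ x ] (reverse p) ⟩
      reverse q ++ x ∷ reverse p     ∎

  path-encoding : PathEncoding _<_
  path-encoding = record
    { path = path
    ; path-last = λ v → reverse (ancestors v) , unfold-reverse v (ancestors v)
    ; <⇒⊏ = <⇒⊏
    ; ⊏⇒< = ⊏⇒<
    ; prefix-closed = prefix-closed
    }

-- The upper bound

module TreeOrder {G : Graph n} (O : TransitiveOrientation G) (P : PathEncoding (Arc O)) where

  open PathEncoding P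

  _<_ : Fin n → Fin n → Set
  _<_ = Arc O

  path-injective : ∀ {u v} → path u ≡ path v → u ≡ v
  path-injective {u} {v} eq with path-last u | path-last v
  ... | p , pu | q , pv = proj₂ (∷ʳ-injective p q (trans (sym pu) (trans eq pv)))

  on-path : ∀ {v} p {x} q → path v ≡ p ++ x ∷ q → x ≡ v ⊎ x < v
  on-path p [] eq = inj₁ (path-injective (trans (prefix-closed p [] eq) (sym eq)))
  on-path {v} p {x} (y ∷ q) eq = inj₂ (⊏⇒< (y , q , (begin
    path v                 ≡⟨ eq ⟩
    p ++ x ∷ y ∷ q         ≡⟨ ++-assoc p [ x ] (y ∷ q) ⟨
    (p ∷ʳ x) ++ y ∷ q      ≡⟨ cong (_++ y ∷ q) (prefix-closed p (y ∷ q) eq) ⟨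
    path x ++ y ∷ q        ∎)))
    where open ≡-Reasoning

  Apart : Fin n → Fin n → Set
  Apart a b = Diverge (path a) (path b)

  position : ∀ {a b} → a ≢ b → a < b ⊎ b < a ⊎ Apart a b
  position {a} {b} a≢b with list-trichotomy (path a) (path b)
  ... | inj₁ eq = ⊥-elim (a≢b (path-injective eq))
  ... | inj₂ (inj₁ a⊏b) = inj₁ (⊏⇒< a⊏b)
  ... | inj₂ (inj₂ (inj₁ b⊏a)) = inj₂ (inj₁ (⊏⇒< b⊏a))
  ... | inj₂ (inj₂ (inj₂ apart)) = inj₂ (inj₂ apart)

  Apart⇒≢ : ∀ {a b} → Apart a b → a ≢ b
  Apart⇒≢ apart refl = Diverge⇒≢-extensions apart [] [] refl

  Apart⇒≮ : ∀ {a b} → Apart a b → ¬ a < b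
  Apart⇒≮ apart a<b with <⇒⊏ a<b
  ... | z , zs , eq = Diverge⇒≢-extensions apart (z ∷ zs) [] (trans (sym eq) (sym (++-identityʳ _)))

  Apart⇒¬adjacent : ∀ {a b} → Apart a b → ¬ Adj G a b
  Apart⇒¬adjacent apart adj = Sum.[ Apart⇒≮ apart , Apart⇒≮ (Diverge-sym apart) ]′ (edge-arc O adj)

  below-common-comparable : ∀ {q s p} → q < p → s < p → q ≢ s → q < s ⊎ s < q
  below-common-comparable q<p s<p q≢s with position q≢s
  ... | inj₁ q<s = inj₁ q<s
  ... | inj₂ (inj₁ s<q) = inj₂ s<q
  ... | inj₂ (inj₂ apart) with <⇒⊏ q<p | <⇒⊏ s<p
  ...   | z , zs , pq | z′ , zs′ , ps =
    ⊥-elim (Diverge⇒≢-extensions apart (z ∷ zs) (z′ ∷ zs′) (trans (sym pq) ps))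

  comparable⇒adjacent : ∀ {a b} → a < b ⊎ b < a → Adj G a b
  comparable⇒adjacent = Sum.[ arc-edge O , Graph.sym G ∘ arc-edge O ]′

  module PathOrder {_≺_ : Fin n → Fin n → Set} (≺-sto : IsStrictTotalOrder _≡_ _≺_) where

    _◁_ : Fin n → Fin n → Set
    _◁_ = Lex-< _≡_ _≺_ on path

    ◁-sto : IsStrictTotalOrder _≡_ _◁_
    ◁-sto = pullback-≡ (Lex-isStrictTotalOrder ≺-sto) path (path-injective ∘ Pointwise-≡⇒≡)

    open IsStrictTotalOrder ◁-sto public using () renaming (asym to ◁-asym)
    open StrictSort ◁-sto

    <⇒◁ : ∀ {a b} → a < b → a ◁ b
    <⇒◁ {a} a<b with <⇒⊏ a<b
    ... | z , zs , eq = subst (Lex-< _≡_ _≺_ (path a)) (sym eq) (Lex-prefix (path a))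

    apart⇒◁ : ∀ {a b c x y xs ys} → path a ≡ c ++ x ∷ xs → path b ≡ c ++ y ∷ ys → x ≺ y → a ◁ b
    apart⇒◁ {c = c} pa pb x≺y = subst₂ (Lex-< _≡_ _≺_) (sym pa) (sym pb) (Lex-diverge c x≺y)

    vertices : List (Fin n)
    vertices = sort (allFin n)

    vertices-sorted : AllPairs _◁_ vertices
    vertices-sorted = sort-strict (Unique.allFin⁺ n)

    ∈-vertices : ∀ v → v ∈ vertices
    ∈-vertices v = ∈-resp-↭ (↭-sym (sort-↭ (allFin n))) (∈-allFin v)

    length-vertices : length vertices ≡ n
    length-vertices = trans (↭-length (sort-↭ (allFin n))) (length-tabulate {n = n} id)

    restrict-vertices : ∀ {a b} → a ◁ b → restrict a b vertices ≡ a ∷ b ∷ []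
    restrict-vertices a◁b = restrict-sorted ◁-asym vertices-sorted (∈-vertices _) (∈-vertices _) a◁b

    restrict-vertices′ : ∀ {a b} → b ◁ a → restrict a b vertices ≡ b ∷ a ∷ []
    restrict-vertices′ {a} {b} b◁a = trans (restrict-comm a b vertices) (restrict-vertices b◁a)

  module Representant (S : List (Fin n)) (S-clique : IsClique G S)
                      (S-maximum : ∀ S′ → IsClique G S′ → length S′ ≤ length S) where

    S-adjacent : ∀ {a b} → a ∈ S → b ∈ S → a ≢ b → Adj G a b
    S-adjacent = AllPairs-lookup (Graph.sym G) (proj₂ S-clique)

    S-down-closed : ∀ {q p} → q < p → p ∈ S → q ∈ S
    S-down-closed {q} {p} q<p p∈S with q ∈? S
    ... | yes q∈S = q∈S
    ... | no q∉S = ⊥-elim (1+n≰n (S-maximum (q ∷ S) q∷S-clique))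
      where
      adjacent : ∀ {s} → s ∈ S → Adj G q s
      adjacent {s} s∈S with s ≟ p
      ... | yes refl = arc-edge O q<p
      ... | no s≢p with edge-arc O (S-adjacent s∈S p∈S s≢p)
      ...   | inj₁ s<p = comparable⇒adjacent (below-common-comparable q<p s<p (λ { refl → q∉S s∈S }))
      ...   | inj₂ p<s = arc-edge O (TransitiveOrientation.trans O q<p p<s)
      q∷S-clique : IsClique G (q ∷ S)
      q∷S-clique = ¬Any⇒All¬ S q∉S ∷ proj₁ S-clique , All.tabulate adjacent ∷ proj₂ S-clique

    -- The vertices of S get the smallest ranks, hence come last among siblings in the reversed order.
    rank : Fin n → ℕ
    rank x = if does (x ∈? S) then toℕ x else n + toℕ x

    rank-∈ : ∀ {x} → x ∈ S → rank x ≡ toℕ x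
    rank-∈ {x} x∈S = cong (if_then toℕ x else n + toℕ x) (dec-true (x ∈? S) x∈S)

    rank-∉ : ∀ {x} → x ∉ S → rank x ≡ n + toℕ x
    rank-∉ {x} x∉S = cong (if_then toℕ x else n + toℕ x) (dec-false (x ∈? S) x∉S)

    rank-S-first : ∀ {x y} → x ∈ S → y ∉ S → rank x <ℕ rank y
    rank-S-first {x} {y} x∈S y∉S =
      subst₂ _<ℕ_ (sym (rank-∈ x∈S)) (sym (rank-∉ y∉S)) (≤-trans (toℕ<n x) (m≤m+n n (toℕ y)))

    rank-injective : ∀ {x y} → rank x ≡ rank y → x ≡ y
    rank-injective {x} {y} eq = by-membership (x ∈? S) (y ∈? S)
      where
      by-membership : Dec (x ∈ S) → Dec (y ∈ S) → x ≡ y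
      by-membership (yes x∈S) (yes y∈S) = toℕ-injective (trans (sym (rank-∈ x∈S)) (trans eq (rank-∈ y∈S)))
      by-membership (no x∉S) (no y∉S) =
        toℕ-injective (+-cancelˡ-≡ n _ _ (trans (sym (rank-∉ x∉S)) (trans eq (rank-∉ y∉S))))
      by-membership (yes x∈S) (no y∉S) = ⊥-elim (<ℕ-irrefl eq (rank-S-first x∈S y∉S))
      by-membership (no x∉S) (yes y∈S) = ⊥-elim (<ℕ-irrefl (sym eq) (rank-S-first y∈S x∉S))

    _≺₁_ : Fin n → Fin n → Set
    _≺₁_ = _<ℕ_ on rank

    ≺₁-sto : IsStrictTotalOrder _≡_ _≺₁_
    ≺₁-sto = pullback-≡ <ℕ-isStrictTotalOrder rank rank-injective

    module O₁ = PathOrder ≺₁-sto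
    module O₂ = PathOrder (Flip.isStrictTotalOrder ≺₁-sto)

    _∉S? : (v : Fin n) → Dec (v ∉ S)
    v ∉S? = ¬? (v ∈? S)

    non-S : List (Fin n)
    non-S = filter _∉S? O₁.vertices

    non-S-sorted : AllPairs O₁._◁_ non-S
    non-S-sorted = AllPairs-filter⁺ _∉S? O₁.vertices-sorted

    ∈-non-S : ∀ {v} → v ∉ S → v ∈ non-S
    ∈-non-S {v} = ∈-filter⁺ _∉S? (O₁.∈-vertices v)

    ∉-non-S : ∀ {v} → v ∈ S → v ∉ non-S
    ∉-non-S v∈S v∈non-S = proj₂ (∈-filter⁻ _∉S? {xs = O₁.vertices} v∈non-S) v∈S

    word : List (Fin n)
    word = non-S ++ O₂.vertices

    restrict-word : ∀ a b → restrict a b word ≡ restrict a b non-S ++ restrict a b O₂.vertices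
    restrict-word a b = restrict-++ a b non-S O₂.vertices

    restrict-non-S-∉ : ∀ {a b} → a ∉ S → b ∉ S → a O₁.◁ b → restrict a b non-S ≡ a ∷ b ∷ []
    restrict-non-S-∉ a∉S b∉S = restrict-sorted O₁.◁-asym non-S-sorted (∈-non-S a∉S) (∈-non-S b∉S)

    restrict-non-S-∈∉ : ∀ {a b} → a ∈ S → b ∉ S → restrict a b non-S ≡ [ b ]
    restrict-non-S-∈∉ {a} {b} a∈S b∉S =
      trans (restrict-comm a b non-S)
            (restrict-single (AllPairs⇒Unique O₁.◁-asym non-S-sorted) (∈-non-S b∉S) (∉-non-S a∈S))

    alternate-comparable : ∀ {a b} → a < b → Alternate a b word
    alternate-comparable {a} {b} a<b with b ∈? S | a ∈? S
    ... | yes b∈S | _ = 2 , inj₁ (trans (restrict-word a b)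
                                (cong₂ _++_ (restrict-∉ non-S (∉-non-S (S-down-closed a<b b∈S)) (∉-non-S b∈S))
                                            (O₂.restrict-vertices (O₂.<⇒◁ a<b))))
    ... | no b∉S | yes a∈S = 3 , inj₂ (trans (restrict-word a b)
                                (cong₂ _++_ (restrict-non-S-∈∉ a∈S b∉S) (O₂.restrict-vertices (O₂.<⇒◁ a<b))))
    ... | no b∉S | no a∉S = 4 , inj₁ (trans (restrict-word a b)
                                (cong₂ _++_ (restrict-non-S-∉ a∉S b∉S (O₁.<⇒◁ a<b))
                                            (O₂.restrict-vertices (O₂.<⇒◁ a<b))))

    ¬alternate-apart-∈∉ : ∀ {a b} → a ∈ S → b ∉ S → Apart a b → ¬ Alternate a b word
    ¬alternate-apart-∈∉ {a} {b} a∈S b∉S apart@(diverge c {x} {y} xs ys x≢y pa pb) =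
      ¬Alternate-square {w = word} (Apart⇒≢ apart) []
        (trans (restrict-word a b) (cong₂ _++_ (restrict-non-S-∈∉ a∈S b∉S) (O₂.restrict-vertices′ b◁₂a)))
      where
      x∈S : x ∈ S
      x∈S = Sum.[ (λ { refl → a∈S }) , (λ x<a → S-down-closed x<a a∈S) ]′ (on-path c xs pa)
      siblings : Apart x y
      siblings = diverge c [] [] x≢y (prefix-closed c xs pa) (prefix-closed c ys pb)
      y∉S : y ∉ S
      y∉S y∈S = Apart⇒¬adjacent siblings (S-adjacent x∈S y∈S x≢y)
      b◁₂a : b O₂.◁ a
      b◁₂a = O₂.apart⇒◁ pb pa (rank-S-first x∈S y∉S)

    ¬alternate-apart-∉∉ : ∀ {a b} → a ∉ S → b ∉ S → Apart a b → ¬ Alternate a b word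
    ¬alternate-apart-∉∉ {a} {b} a∉S b∉S apart@(diverge c {x} {y} xs ys x≢y pa pb)
      with IsStrictTotalOrder.compare ≺₁-sto x y
    ... | tri< x≺y _ _ = ¬Alternate-square {w = word} (Apart⇒≢ apart) [ a ]
      (trans (restrict-word a b)
             (cong₂ _++_ (restrict-non-S-∉ a∉S b∉S (O₁.apart⇒◁ pa pb x≺y))
                         (O₂.restrict-vertices′ (O₂.apart⇒◁ pb pa x≺y))))
    ... | tri≈ _ x≡y _ = λ _ → x≢y x≡y
    ... | tri> _ _ y≺x = ¬Alternate-square {w = word} (Apart⇒≢ apart) [ b ]
      (trans (restrict-word a b)
             (cong₂ _++_ (trans (restrict-comm a b non-S) (restrict-non-S-∉ b∉S a∉S (O₁.apart⇒◁ pb pa y≺x)))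
                         (O₂.restrict-vertices (O₂.apart⇒◁ pa pb y≺x))))

    ¬alternate-apart : ∀ {a b} → Apart a b → ¬ Alternate a b word
    ¬alternate-apart {a} {b} apart with a ∈? S | b ∈? S
    ... | yes a∈S | yes b∈S = λ _ → Apart⇒¬adjacent apart (S-adjacent a∈S b∈S (Apart⇒≢ apart))
    ... | yes a∈S | no b∉S = ¬alternate-apart-∈∉ a∈S b∉S apart
    ... | no a∉S | yes b∈S = ¬alternate-apart-∈∉ b∈S a∉S (Diverge-sym apart) ∘ Alternate-comm {w = word}
    ... | no a∉S | no b∉S = ¬alternate-apart-∉∉ a∉S b∉S apart

    represents : Represents G word
    represents = (λ v → ∈-++⁺ʳ non-S (O₂.∈-vertices v)) , agree
      where
      agree : ∀ a b → a ≢ b → (Adj G a b → Alternate a b word) × (Alternate a b word → Adj G a b)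
      agree a b a≢b with position a≢b
      ... | inj₁ a<b = (λ _ → alternate-comparable a<b) , (λ _ → arc-edge O a<b)
      ... | inj₂ (inj₁ b<a) =
        (λ _ → Alternate-comm {w = word} (alternate-comparable b<a)) , (λ _ → Graph.sym G (arc-edge O b<a))
      ... | inj₂ (inj₂ apart) = ⊥-elim ∘ Apart⇒¬adjacent apart , ⊥-elim ∘ ¬alternate-apart apart

    length-word : length word ≡ 2 * n ∸ length S
    length-word = begin
      length word                             ≡⟨ length-++ non-S ⟩
      length non-S + length O₂.vertices       ≡⟨ cong (length non-S +_) O₂.length-vertices ⟩
      length non-S + n                        ≡⟨ m+n∸n≡m (length non-S + n) (length S) ⟨
      length non-S + n + length S ∸ length S  ≡⟨ cong (_∸ length S) two-n ⟩
      2 * n ∸ length S                        ∎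
      where
      open ≡-Reasoning
      partition : length non-S + length S ≡ n
      partition = complement-length (AllPairs⇒Unique O₁.◁-asym non-S-sorted) (proj₁ S-clique) ∈-non-S ∉-non-S
      two-n : length non-S + n + length S ≡ 2 * n
      two-n = begin
        length non-S + n + length S    ≡⟨ +-assoc (length non-S) n (length S) ⟩
        length non-S + (n + length S)  ≡⟨ cong (length non-S +_) (+-comm n (length S)) ⟩
        length non-S + (length S + n)  ≡⟨ +-assoc (length non-S) (length S) n ⟨
        length non-S + length S + n    ≡⟨ cong (_+ n) partition ⟩
        n + n                          ≡⟨ cong (n +_) (+-identityʳ n) ⟨
        2 * n                          ∎

theorem8 : (n : ℕ) (G : Graph n) (k : ℕ) → Arborescence G → CliqueNumber G k →
    (Σ (List (Fin n)) λ w → Represents G w × length w ≡ 2 * n ∸ k) ×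
    (∀ (w : List (Fin n)) → Represents G w → 2 * n ∸ k ≤ length w)
theorem8 n G k arborescence ((S , S-clique , |S|≡k) , clique≤k) =
  (word , represents , trans length-word (cong (2 * n ∸_) |S|≡k)) , lower-bound G k clique≤k
  where
  rooted : SourceRooted
  rooted = source-rooted arborescence
  S-maximum : ∀ S′ → IsClique G S′ → length S′ ≤ length S
  S-maximum S′ S′-clique = subst (length S′ ≤_) (sym |S|≡k) (clique≤k S′ S′-clique)
  open TreeOrder.Representant (SourceRooted.orientation rooted) (RootedTree.path-encoding rooted) S S-clique S-maximum
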